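{- Let $M$ be a matroid on ground set $E$ without loops or coloops such that $B(M)$ is 2-level, and let $S$ be a $0/1$ slack matrix of $B(M)$ with no constant row and containing, for each $e\in E$, rows corresponding to $x_e\geq0$ and to $1-x_e\geq0$. Then $M$ is connected if and only if $S$ is irreducible.
   Context: $B(M)$ is the convex hull of characteristic vectors of bases of $M$. A slack matrix of a polytope $P=\mathrm{conv}\{v_1,\dots,v_n\}=\{x:Ax\leq b,A^=x=b^=\}$ ($v_j$ the vertices) has entries $S_{ij}=b_i-A_iv_j$; rows correspond to inequalities. A polytope is 2-level if it has a $0/1$ slack matrix. A matroid is connected if it is not the 1-sum (direct sum) of two matroids each on fewer elements. A matrix is irreducible if it is not a 1-product, i.e. not equal up to permuting rows and columns to $S_1\otimes S_2$ for non-empty $S_1,S_2$, where $S_1\otimes S_2$ has as columns all concatenations of a column of $S_1$ on top of a column of $S_2$. -}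

module Defs where

open import Data.Nat using (ℕ; zero; suc; _+_; _≥_)
open import Data.Bool using (Bool; true; false; if_then_else_; _∧_)
open import Data.Fin using (Fin; zero; suc; _≟_)
open import Data.Vec using (Vec; lookup; take; drop; tabulate)
open import Data.List using (List; []; _∷_; map; foldr)
open import Data.List.Relation.Unary.All using (All)
open import Data.Product using (Σ; ∃; _×_; _,_; proj₁; proj₂)
open import Data.Sum using (_⊎_; inj₁; inj₂)
open import Data.Rational using (ℚ; 0ℚ; 1ℚ; _≤_; -_)
import Data.Rational as ℚ
open import Relation.Nullary using (¬_; yes; no)
open import Relation.Nullary.Decidable using (⌊_⌋)
open import Relation.Binary.PropositionalEquality using (_≡_)
open import Function.Bundles using (_↔_; _⇔_; Inverse)

-- Matroids on the ground set E = Fin n, given by their bases.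
-- A subset of E is a Bool vector (true = member).

Sub : ℕ → Set
Sub n = Vec Bool n

_∈ₛ_ : ∀ {n} → Fin n → Sub n → Set
e ∈ₛ B = lookup B e ≡ true

_∉ₛ_ : ∀ {n} → Fin n → Sub n → Set
e ∉ₛ B = lookup B e ≡ false

swap : ∀ {n} → Sub n → Fin n → Fin n → Sub n
swap B x y = tabulate λ i →
  if ⌊ i ≟ y ⌋ then true else (if ⌊ i ≟ x ⌋ then false else lookup B i)

record Matroid (n : ℕ) : Set where
  field
    isBase   : Sub n → Bool
    nonempty : ∃ λ B → isBase B ≡ true
    exchange : ∀ B₁ B₂ → isBase B₁ ≡ true → isBase B₂ ≡ true →
               ∀ x → x ∈ₛ B₁ → x ∉ₛ B₂ →
               ∃ λ y → y ∈ₛ B₂ × y ∉ₛ B₁ × isBase (swap B₁ x y) ≡ true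

open Matroid public

IsBase : ∀ {n} → Matroid n → Sub n → Set
IsBase M B = isBase M B ≡ true

IsLoop : ∀ {n} → Matroid n → Fin n → Set
IsLoop M e = ∀ B → IsBase M B → e ∉ₛ B

IsColoop : ∀ {n} → Matroid n → Fin n → Set
IsColoop M e = ∀ B → IsBase M B → e ∈ₛ B

directSumBase : ∀ {k l} → Matroid k → Matroid l → Sub (k + l) → Bool
directSumBase {k} M₁ M₂ B = isBase M₁ (take k B) ∧ isBase M₂ (drop k B)

relabel : ∀ {m n} → (Fin m ↔ Fin n) → Sub m → Sub n
relabel σ B = tabulate λ i → lookup B (Inverse.from σ i)

-- M is a 1-sum (direct sum) of two matroids each on fewer elements
-- (i.e. each on at least one element), up to isomorphism.
IsOneSum : ∀ {n} → Matroid n → Set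
IsOneSum {n} M =
  Σ ℕ λ k → Σ ℕ λ l → k ≥ 1 × l ≥ 1 ×
  Σ (Matroid k) λ M₁ → Σ (Matroid l) λ M₂ → Σ (Fin (k + l) ↔ Fin n) λ σ →
    ∀ B → directSumBase M₁ M₂ B ≡ isBase M (relabel σ B)

Connected : ∀ {n} → Matroid n → Set
Connected M = ¬ IsOneSum M

Point : ℕ → Set
Point n = Fin n → ℚ

boolℚ : Bool → ℚ
boolℚ true  = 1ℚ
boolℚ false = 0ℚ

χ : ∀ {n} → Sub n → Point n
χ B i = boolℚ (lookup B i)

Σℚ : ∀ {n} → (Fin n → ℚ) → ℚ
Σℚ {zero}  f = 0ℚ
Σℚ {suc n} f = f zero ℚ.+ Σℚ (λ i → f (suc i))

dot : ∀ {n} → Point n → Point n → ℚ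
dot a x = Σℚ λ i → a i ℚ.* x i

-- x lies in B(M) = conv { χ_B : B basis of M }: x is a convex combination
-- (finite list of coefficient/basis pairs) of characteristic vectors of bases.
InBasePolytope : ∀ {n} → Matroid n → Point n → Set
InBasePolytope {n} M x =
  Σ (List (ℚ × Sub n)) λ L →
    All (λ p → IsBase M (proj₂ p)) L ×
    All (λ p → 0ℚ ≤ proj₁ p) L ×
    foldr (λ p s → proj₁ p ℚ.+ s) 0ℚ L ≡ 1ℚ ×
    (∀ i → x i ≡ foldr (λ p s → proj₁ p ℚ.* χ (proj₂ p) i ℚ.+ s) 0ℚ L)

BMat : ℕ → ℕ → Set
BMat m c = Fin m → Fin c → Bool

-- S is a (0/1) slack matrix of B(M) w.r.t. a description
--   B(M) = { x : A x ≤ b , A= x = b= }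
-- with rows of S indexed by the inequalities A_i x ≤ b_i and columns by the
-- vertices of B(M), i.e. (bijectively) by the bases of M.
record SlackData {n m c : ℕ} (M : Matroid n) (S : BMat m c) : Set where
  field
    A    : Fin m → Point n
    b    : Fin m → ℚ
    p    : ℕ
    Aeq  : Fin p → Point n
    beq  : Fin p → ℚ
    vert : Fin c → Sub n
    vert-base : ∀ j → IsBase M (vert j)
    vert-inj  : ∀ j j' → vert j ≡ vert j' → j ≡ j'
    vert-surj : ∀ B → IsBase M B → ∃ λ j → vert j ≡ B
    describes : ∀ x → InBasePolytope M x ⇔
                  ((∀ i → dot (A i) x ≤ b i) × (∀ k → dot (Aeq k) x ≡ beq k))
    slack     : ∀ i j → boolℚ (S i j) ≡ b i ℚ.- dot (A i) (χ (vert j))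

δ : ∀ {n} → Fin n → Point n
δ e i with i ≟ e
... | yes _ = 1ℚ
... | no _  = 0ℚ

RowNonneg : ∀ {n m c} {M : Matroid n} {S : BMat m c} → SlackData M S → Fin m → Fin n → Set
RowNonneg D i e = (∀ k → SlackData.A D i k ≡ - δ e k) × SlackData.b D i ≡ 0ℚ

RowUpper : ∀ {n m c} {M : Matroid n} {S : BMat m c} → SlackData M S → Fin m → Fin n → Set
RowUpper D i e = (∀ k → SlackData.A D i k ≡ δ e k) × SlackData.b D i ≡ 1ℚ

-- B(M) is 2-level: it has a 0/1 slack matrix
TwoLevel : ∀ {n} → Matroid n → Set
TwoLevel M = Σ ℕ λ m → Σ ℕ λ c → Σ (BMat m c) λ S → SlackData M S

ConstantRow : ∀ {m c} → BMat m c → Fin m → Set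
ConstantRow S i = ∃ λ v → ∀ j → S i j ≡ v

-- 1-products and irreducibility.
-- S₁ ⊗ S₂ has rows Fin m₁ ⊎ Fin m₂ and columns Fin c₁ × Fin c₂, the column
-- (j₁ , j₂) being column j₁ of S₁ on top of column j₂ of S₂.

tensor : ∀ {m₁ c₁ m₂ c₂} → BMat m₁ c₁ → BMat m₂ c₂ →
         (Fin m₁ ⊎ Fin m₂) → (Fin c₁ × Fin c₂) → Bool
tensor S₁ S₂ (inj₁ i) (j₁ , j₂) = S₁ i j₁
tensor S₁ S₂ (inj₂ i) (j₁ , j₂) = S₂ i j₂

IsOneProduct : ∀ {m c} → BMat m c → Set
IsOneProduct {m} {c} S =
  Σ ℕ λ m₁ → Σ ℕ λ c₁ → Σ ℕ λ m₂ → Σ ℕ λ c₂ →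
  m₁ ≥ 1 × c₁ ≥ 1 × m₂ ≥ 1 × c₂ ≥ 1 ×
  Σ (BMat m₁ c₁) λ S₁ → Σ (BMat m₂ c₂) λ S₂ →
  Σ ((Fin m₁ ⊎ Fin m₂) ↔ Fin m) λ ρ → Σ ((Fin c₁ × Fin c₂) ↔ Fin c) λ κ →
    ∀ r q → S (Inverse.to ρ r) (Inverse.to κ q) ≡ tensor S₁ S₂ r q

Irreducible : ∀ {m c} → BMat m c → Set
Irreducible S = ¬ IsOneProduct S

-- The x_e ≥ 0 row of the slack matrix is the e-th coordinate of the vertices χ_B.
-- If S = S₁ ⊗ S₂, each of these rows lies in one of the two blocks; this splits E = E₁ ⊔ E₂
-- so that the E₁-part of a vertex depends only on its S₁-column and the E₂-part only on its
-- S₂-column. Hence the bases are closed under exchanging E₂-parts ("rectangular"), which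
-- makes M the direct sum of its fibres over E₁ and E₂.
-- Conversely, if M = M₁ ⊕ M₂ the columns form a rectangular band p · q (the base with the
-- E₁-part of p and the E₂-part of q). Slacks are affine in the vertex, so every row satisfies
-- S(p·q) + S(p'·q') = S(p·q') + S(p'·q), and a 0/1 row with this property depends on only one
-- factor. Grouping the rows accordingly writes S as a 1-product; both row blocks are
-- non-empty because the x_e ≥ 0 rows are non-constant.

module Submission where

open import Defs
open import Data.Nat using (ℕ; zero; suc; _≥_; >-nonZero⁻¹) renaming (_+_ to _+ℕ_)
open import Data.Fin using (Fin; zero; suc; join; splitAt; fromℕ<) renaming (_≟_ to _≟ᶠ_)
open import Data.Fin.Properties using (splitAt-join; join-splitAt; +↔⊎; all?; ¬∀⟶∃¬; nonZeroIndex)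
open import Data.Bool using (Bool; true; false; _∧_; if_then_else_)
import Data.Bool as Bool
open import Data.Bool.Properties using (∧-conicalˡ; ∧-conicalʳ; ¬-not)
open import Data.Vec using (Vec; lookup; tabulate; take; drop; _++_)
open import Data.Vec.Properties
  using (lookup∘tabulate; tabulate∘lookup; tabulate-cong; take++drop≡id; lookup-splitAt; ++-injective)
open import Data.Product using (Σ; ∃; ∃₂; _×_; _,_; proj₁; proj₂)
open import Data.Sum using (_⊎_; inj₁; inj₂; [_,_]′)
import Data.Sum as Sum
open import Data.Sum.Properties using (≡-dec; inj₁-injective; swap-↔)
open import Data.Sum.Algebra using (⊎-cong; ⊎-assoc)
open import Data.Empty using (⊥-elim)
open import Data.Rational using (ℚ; 0ℚ; 1ℚ; -_; _+_; _-_; _*_)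
import Data.Rational.Properties as ℚᴾ
open import Data.Rational.Solver using (module +-*-Solver)
open import Algebra.Properties.CommutativeMonoid.Sum ℚᴾ.+-0-commutativeMonoid
  using (sum; sum-cong-≗; ∑-distrib-+)
open import Relation.Nullary using (¬_; Dec; does; yes; no)
open import Relation.Nullary.Decidable using (⌊_⌋; dec-true; dec-false)
open import Relation.Binary.Definitions using (DecidableEquality)
open import Relation.Binary.PropositionalEquality
open import Function.Bundles using (_↔_; Inverse; Injection; mk↔ₛ′; _⇔_; mk⇔)
open import Function.Properties.Inverse using (↔-refl; ↔-trans; ↔-sym; ↔⇒↣)
open import Level using (0ℓ)

lookup-ext : ∀ {A : Set} {n} (xs ys : Vec A n) → (∀ i → lookup xs i ≡ lookup ys i) → xs ≡ ys
lookup-ext xs ys eq = begin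
  xs                   ≡⟨ tabulate∘lookup xs ⟨
  tabulate (lookup xs) ≡⟨ tabulate-cong eq ⟩
  tabulate (lookup ys) ≡⟨ tabulate∘lookup ys ⟩
  ys                   ∎
  where open ≡-Reasoning

⌊≟⌋-injective : ∀ {A B : Set} (_≟ᴬ_ : DecidableEquality A) (_≟ᴮ_ : DecidableEquality B)
                {f : A → B} → (∀ {u v} → f u ≡ f v → u ≡ v) →
                ∀ u v → ⌊ f u ≟ᴮ f v ⌋ ≡ ⌊ u ≟ᴬ v ⌋
⌊≟⌋-injective _≟ᴬ_ _≟ᴮ_ {f} f-inj u v with u ≟ᴬ v | f u ≟ᴮ f v
... | yes _    | yes _    = refl
... | no _     | no _     = refl
... | yes refl | no fu≢fu = ⊥-elim (fu≢fu refl)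
... | no u≢v   | yes fu≡fv = ⊥-elim (u≢v (f-inj fu≡fv))

lookup-swap : ∀ {n} (B : Sub n) x y i →
  lookup (swap B x y) i ≡ (if ⌊ i ≟ᶠ y ⌋ then true else (if ⌊ i ≟ᶠ x ⌋ then false else lookup B i))
lookup-swap B x y = lookup∘tabulate _

from-does-true : ∀ {A : Set} (a? : Dec A) → does a? ≡ true → A
from-does-true (yes a) _ = a

from-does-false : ∀ {A : Set} (a? : Dec A) → does a? ≡ false → ¬ A
from-does-false (no ¬a) _ = ¬a

true≢false : true ≢ false
true≢false ()

≡-from-true⇔true : ∀ {u v} → (u ≡ true → v ≡ true) → (v ≡ true → u ≡ true) → u ≡ v
≡-from-true⇔true {true}  {true}  _ _ = refl
≡-from-true⇔true {false} {false} _ _ = refl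
≡-from-true⇔true {true}  {false} u⇒v _ = sym (u⇒v refl)
≡-from-true⇔true {false} {true}  _ v⇒u = v⇒u refl

boolℚ-injective : ∀ {u v} → boolℚ u ≡ boolℚ v → u ≡ v
boolℚ-injective {true}  {true}  _ = refl
boolℚ-injective {false} {false} _ = refl

boolℚ-interchange : ∀ {w x y z} → boolℚ w + boolℚ x ≡ boolℚ y + boolℚ z → w ≢ y → w ≡ z × x ≡ y
boolℚ-interchange {true}  {_}     {true}          _  w≢y = ⊥-elim (w≢y refl)
boolℚ-interchange {false} {_}     {false}         _  w≢y = ⊥-elim (w≢y refl)
boolℚ-interchange {true}  {false} {false} {true}  _  _   = refl , refl
boolℚ-interchange {false} {true}  {true}  {false} _  _   = refl , refl
boolℚ-interchange {true}  {true}  {false} {true}  () _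
boolℚ-interchange {true}  {true}  {false} {false} () _
boolℚ-interchange {true}  {false} {false} {false} () _
boolℚ-interchange {false} {true}  {true}  {true}  () _
boolℚ-interchange {false} {false} {true}  {true}  () _
boolℚ-interchange {false} {false} {true}  {false} () _

Σℚ≡sum : ∀ {n} (f : Fin n → ℚ) → Σℚ f ≡ sum f
Σℚ≡sum {zero}  f = refl
Σℚ≡sum {suc n} f = cong (f zero +_) (Σℚ≡sum (λ i → f (suc i)))

dot-cong : ∀ {n} {a a' x x' : Point n} → (∀ i → a i ≡ a' i) → (∀ i → x i ≡ x' i) →
           dot a x ≡ dot a' x'
dot-cong {a = a} {a'} {x} {x'} a≗a' x≗x' = begin
  dot a x                   ≡⟨ Σℚ≡sum (λ i → a i * x i) ⟩
  sum (λ i → a i * x i)     ≡⟨ sum-cong-≗ (λ i → cong₂ _*_ (a≗a' i) (x≗x' i)) ⟩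
  sum (λ i → a' i * x' i)   ≡⟨ Σℚ≡sum (λ i → a' i * x' i) ⟨
  dot a' x'                 ∎
  where open ≡-Reasoning

dot-distribʳ-+ : ∀ {n} (a x y : Point n) → dot a (λ i → x i + y i) ≡ dot a x + dot a y
dot-distribʳ-+ a x y = begin
  dot a (λ i → x i + y i)                      ≡⟨ Σℚ≡sum (λ i → a i * (x i + y i)) ⟩
  sum (λ i → a i * (x i + y i))                ≡⟨ sum-cong-≗ (λ i → ℚᴾ.*-distribˡ-+ (a i) (x i) (y i)) ⟩
  sum (λ i → a i * x i + a i * y i)            ≡⟨ ∑-distrib-+ (λ i → a i * x i) (λ i → a i * y i) ⟩
  sum (λ i → a i * x i) + sum (λ i → a i * y i) ≡⟨ cong₂ _+_ (Σℚ≡sum (λ i → a i * x i)) (Σℚ≡sum (λ i → a i * y i)) ⟨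
  dot a x + dot a y                            ∎
  where open ≡-Reasoning

slack-interchange : ∀ {n} (a : Point n) (b : ℚ) {x y z w : Point n} →
  (∀ i → x i + y i ≡ z i + w i) →
  (b - dot a x) + (b - dot a y) ≡ (b - dot a z) + (b - dot a w)
slack-interchange a b {x} {y} {z} {w} eq = begin
  (b - dot a x) + (b - dot a y)  ≡⟨ regroup (dot a x) (dot a y) ⟩
  (b + b) - (dot a x + dot a y)  ≡⟨ cong (λ s → (b + b) - s) sums ⟩
  (b + b) - (dot a z + dot a w)  ≡⟨ regroup (dot a z) (dot a w) ⟨
  (b - dot a z) + (b - dot a w)  ∎
  where
  open ≡-Reasoning
  open +-*-Solver
  regroup : ∀ u v → (b - u) + (b - v) ≡ (b + b) - (u + v)
  regroup = solve 3 (λ b u v → (b :- u) :+ (b :- v) := (b :+ b) :- (u :+ v)) refl b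
  sums : dot a x + dot a y ≡ dot a z + dot a w
  sums = begin
    dot a x + dot a y        ≡⟨ dot-distribʳ-+ a x y ⟨
    dot a (λ i → x i + y i)  ≡⟨ dot-cong {a = a} (λ _ → refl) eq ⟩
    dot a (λ i → z i + w i)  ≡⟨ dot-distribʳ-+ a z w ⟩
    dot a z + dot a w        ∎

dot-zeroˡ : ∀ {n} (x : Point n) → dot (λ _ → 0ℚ) x ≡ 0ℚ
dot-zeroˡ {zero}  x = refl
dot-zeroˡ {suc n} x = cong₂ _+_ (ℚᴾ.*-zeroˡ (x zero)) (dot-zeroˡ (λ i → x (suc i)))

dot-negˡ : ∀ {n} (a x : Point n) → dot (λ i → - a i) x ≡ - dot a x
dot-negˡ {zero}  a x = refl
dot-negˡ {suc n} a x = begin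
  - a zero * x zero + dot (λ i → - a₊ i) x₊  ≡⟨ cong₂ _+_ (sym (ℚᴾ.neg-distribˡ-* (a zero) (x zero))) (dot-negˡ a₊ x₊) ⟩
  - (a zero * x zero) + - dot a₊ x₊         ≡⟨ ℚᴾ.neg-distrib-+ (a zero * x zero) (dot a₊ x₊) ⟨
  - dot a x                                 ∎
  where
  open ≡-Reasoning
  a₊ x₊ : Point n
  a₊ i = a (suc i)
  x₊ i = x (suc i)

δ-suc : ∀ {n} (e k : Fin n) → δ (suc e) (suc k) ≡ δ e k
δ-suc e k with k ≟ᶠ e
... | yes _ = refl
... | no _  = refl

dot-δˡ : ∀ {n} (e : Fin n) (x : Point n) → dot (δ e) x ≡ x e
dot-δˡ zero    x = begin
  1ℚ * x zero + dot (λ _ → 0ℚ) (λ i → x (suc i))  ≡⟨ cong₂ _+_ (ℚᴾ.*-identityˡ (x zero)) (dot-zeroˡ (λ i → x (suc i))) ⟩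
  x zero + 0ℚ                                     ≡⟨ ℚᴾ.+-identityʳ (x zero) ⟩
  x zero                                          ∎
  where open ≡-Reasoning
dot-δˡ (suc e) x = begin
  0ℚ * x zero + dot (λ k → δ (suc e) (suc k)) (λ i → x (suc i)) ≡⟨ cong₂ _+_ (ℚᴾ.*-zeroˡ (x zero)) (dot-cong (δ-suc e) (λ _ → refl)) ⟩
  0ℚ + dot (δ e) (λ i → x (suc i))                             ≡⟨ ℚᴾ.+-identityˡ _ ⟩
  dot (δ e) (λ i → x (suc i))                                  ≡⟨ dot-δˡ e (λ i → x (suc i)) ⟩
  x (suc e)                                                    ∎
  where open ≡-Reasoning

nonnegRow-slack : ∀ {n m c} {M : Matroid n} {S : BMat m c} (D : SlackData M S) {i e} →
                  RowNonneg D i e → ∀ j → S i j ≡ lookup (SlackData.vert D j) e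
nonnegRow-slack {n} {S = S} D {i} {e} (Aᵢ≗-δₑ , bᵢ≡0) j = boolℚ-injective (begin
  boolℚ (S i j)                  ≡⟨ slack i j ⟩
  b i - dot (A i) x              ≡⟨ cong₂ _-_ bᵢ≡0 (dot-cong Aᵢ≗-δₑ (λ _ → refl)) ⟩
  0ℚ - dot (λ k → - δ e k) x     ≡⟨ cong (λ t → 0ℚ - t) (trans (dot-negˡ (δ e) x) (cong -_ (dot-δˡ e x))) ⟩
  0ℚ - (- x e)                   ≡⟨ solve 1 (λ t → con 0ℚ :- (:- t) := t) refl (x e) ⟩
  x e                            ∎)
  where
  open ≡-Reasoning
  open +-*-Solver
  open SlackData D
  x : Point n
  x = χ (vert j)

module Glue {k l n : ℕ} (τ : (Fin k ⊎ Fin l) ↔ Fin n) where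
  open Inverse τ using (to; from; strictlyInverseˡ; strictlyInverseʳ)

  to-injective : ∀ {s t} → to s ≡ to t → s ≡ t
  to-injective = Injection.injective (↔⇒↣ τ)

  all-to : (P : Fin n → Set) → (∀ s → P (to s)) → ∀ e → P e
  all-to P P∘to e = subst P (strictlyInverseˡ e) (P∘to (from e))

  glue : Sub k → Sub l → Sub n
  glue X Y = tabulate (λ e → [ lookup X , lookup Y ]′ (from e))

  left : Sub n → Sub k
  left B = tabulate (λ a → lookup B (to (inj₁ a)))

  right : Sub n → Sub l
  right B = tabulate (λ b → lookup B (to (inj₂ b)))

  lookup-glue : ∀ X Y s → lookup (glue X Y) (to s) ≡ [ lookup X , lookup Y ]′ s
  lookup-glue X Y s = trans (lookup∘tabulate _ (to s)) (cong [ lookup X , lookup Y ]′ (strictlyInverseʳ s))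

  lookup-left : ∀ B a → lookup (left B) a ≡ lookup B (to (inj₁ a))
  lookup-left B = lookup∘tabulate _

  lookup-right : ∀ B b → lookup (right B) b ≡ lookup B (to (inj₂ b))
  lookup-right B = lookup∘tabulate _

  ext-to : ∀ {B B' : Sub n} → (∀ s → lookup B (to s) ≡ lookup B' (to s)) → B ≡ B'
  ext-to {B} {B'} eq = lookup-ext B B' (all-to (λ e → lookup B e ≡ lookup B' e) eq)

  left-glue : ∀ X Y → left (glue X Y) ≡ X
  left-glue X Y = lookup-ext (left (glue X Y)) X λ a → trans (lookup-left (glue X Y) a) (lookup-glue X Y (inj₁ a))

  right-glue : ∀ X Y → right (glue X Y) ≡ Y
  right-glue X Y = lookup-ext (right (glue X Y)) Y λ b → trans (lookup-right (glue X Y) b) (lookup-glue X Y (inj₂ b))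

  glue-left-right : ∀ B → glue (left B) (right B) ≡ B
  glue-left-right B = ext-to λ where
    (inj₁ a) → trans (lookup-glue (left B) (right B) (inj₁ a)) (lookup-left B a)
    (inj₂ b) → trans (lookup-glue (left B) (right B) (inj₂ b)) (lookup-right B b)

  χ-glue-interchange : ∀ X Y X' Y' e →
    χ (glue X Y) e + χ (glue X' Y') e ≡ χ (glue X Y') e + χ (glue X' Y) e
  χ-glue-interchange X Y X' Y' = all-to _ λ s → begin
    χ (glue X Y) (to s) + χ (glue X' Y') (to s)  ≡⟨ cong₂ _+_ (χ-glue X Y s) (χ-glue X' Y' s) ⟩
    χ⊎ X Y s + χ⊎ X' Y' s                        ≡⟨ interchange s ⟩
    χ⊎ X Y' s + χ⊎ X' Y s                        ≡⟨ cong₂ _+_ (χ-glue X Y' s) (χ-glue X' Y s) ⟨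
    χ (glue X Y') (to s) + χ (glue X' Y) (to s)  ∎
    where
    open ≡-Reasoning
    χ⊎ : Sub k → Sub l → Fin k ⊎ Fin l → ℚ
    χ⊎ X Y s = boolℚ ([ lookup X , lookup Y ]′ s)
    χ-glue : ∀ X Y s → χ (glue X Y) (to s) ≡ χ⊎ X Y s
    χ-glue X Y s = cong boolℚ (lookup-glue X Y s)
    interchange : ∀ s → χ⊎ X Y s + χ⊎ X' Y' s ≡ χ⊎ X Y' s + χ⊎ X' Y s
    interchange (inj₁ a) = refl
    interchange (inj₂ b) = ℚᴾ.+-comm (boolℚ (lookup Y b)) (boolℚ (lookup Y' b))

  swap-glue : ∀ X Y x a → swap (glue X Y) (to (inj₁ x)) (to (inj₁ a)) ≡ glue (swap X x a) Y
  swap-glue X Y x a = ext-to pointwise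
    where
    ⌊≟⌋-to-inj₁ : ∀ c d → ⌊ to (inj₁ c) ≟ᶠ to (inj₁ d) ⌋ ≡ ⌊ c ≟ᶠ d ⌋
    ⌊≟⌋-to-inj₁ = ⌊≟⌋-injective _≟ᶠ_ _≟ᶠ_ (λ eq → inj₁-injective (to-injective eq))
    ⌊≟⌋-to-inj₂ : ∀ b d → ⌊ to (inj₂ b) ≟ᶠ to (inj₁ d) ⌋ ≡ false
    ⌊≟⌋-to-inj₂ b d = ⌊≟⌋-injective (≡-dec _≟ᶠ_ _≟ᶠ_) _≟ᶠ_ to-injective (inj₂ b) (inj₁ d)
    pointwise : ∀ s → lookup (swap (glue X Y) (to (inj₁ x)) (to (inj₁ a))) (to s) ≡
                      lookup (glue (swap X x a) Y) (to s)
    pointwise (inj₁ c)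
      rewrite lookup-swap (glue X Y) (to (inj₁ x)) (to (inj₁ a)) (to (inj₁ c))
            | ⌊≟⌋-to-inj₁ c a | ⌊≟⌋-to-inj₁ c x
            | lookup-glue X Y (inj₁ c) | lookup-glue (swap X x a) Y (inj₁ c)
            = sym (lookup-swap X x a c)
    pointwise (inj₂ b)
      rewrite lookup-swap (glue X Y) (to (inj₁ x)) (to (inj₁ a)) (to (inj₂ b))
            | ⌊≟⌋-to-inj₂ b a | ⌊≟⌋-to-inj₂ b x
            | lookup-glue X Y (inj₂ b) | lookup-glue (swap X x a) Y (inj₂ b)
            = refl

  relabel-glue : (σ : Fin (k +ℕ l) ↔ Fin n) → (∀ e → Inverse.from σ e ≡ join k l (from e)) →
                 ∀ B → relabel σ B ≡ glue (take k B) (drop k B)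
  relabel-glue σ from-σ B = lookup-ext _ _ λ e → begin
    lookup (relabel σ B) e                               ≡⟨ lookup∘tabulate _ e ⟩
    lookup B (Inverse.from σ e)                          ≡⟨ cong (lookup B) (from-σ e) ⟩
    lookup B (join k l (from e))                         ≡⟨ cong (λ V → lookup V (join k l (from e))) (take++drop≡id k B) ⟨
    lookup (take k B ++ drop k B) (join k l (from e))    ≡⟨ lookup-splitAt k (take k B) (drop k B) (join k l (from e)) ⟩
    [ lookup (take k B) , lookup (drop k B) ]′ (splitAt k (join k l (from e)))
                                                         ≡⟨ cong [ lookup (take k B) , lookup (drop k B) ]′ (splitAt-join k l (from e)) ⟩
    [ lookup (take k B) , lookup (drop k B) ]′ (from e)  ≡⟨ lookup∘tabulate _ e ⟨
    lookup (glue (take k B) (drop k B)) e                ∎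
    where open ≡-Reasoning

glue-comm : ∀ {k l n} (τ : (Fin k ⊎ Fin l) ↔ Fin n) X Y →
            Glue.glue (↔-trans swap-↔ τ) Y X ≡ Glue.glue τ X Y
glue-comm τ X Y = lookup-ext _ _ λ e →
  trans (lookup∘tabulate _ e) (trans ([,]-swap (Inverse.from τ e)) (sym (lookup∘tabulate _ e)))
  where
  [,]-swap : ∀ s → [ lookup Y , lookup X ]′ (Sum.swap s) ≡ [ lookup X , lookup Y ]′ s
  [,]-swap (inj₁ a) = refl
  [,]-swap (inj₂ b) = refl

isLeft : ∀ {A B : Set} → A ⊎ B → Bool
isLeft = [ (λ _ → true) , (λ _ → false) ]′

record Splitting {n} (P : Fin n → Bool) : Set where
  field
    k l  : ℕ
    τ    : (Fin k ⊎ Fin l) ↔ Fin n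
    P∘to : ∀ s → P (Inverse.to τ s) ≡ isLeft s

consˡ : ∀ {k l n} → (Fin k ⊎ Fin l) ↔ Fin n → (Fin (suc k) ⊎ Fin l) ↔ Fin (suc n)
consˡ {k} {l} τ =
  ↔-trans (⊎-cong +↔⊎ ↔-refl)
    (↔-trans (⊎-assoc 0ℓ (Fin 1) (Fin k) (Fin l))
      (↔-trans (⊎-cong ↔-refl τ) (↔-sym +↔⊎)))

consʳ : ∀ {k l n} → (Fin k ⊎ Fin l) ↔ Fin n → (Fin k ⊎ Fin (suc l)) ↔ Fin (suc n)
consʳ τ = ↔-trans swap-↔ (consˡ (↔-trans swap-↔ τ))

splitBy : ∀ {n} (P : Fin n → Bool) → Splitting P
splitBy {zero} P = record { k = 0 ; l = 0 ; τ = ↔-sym +↔⊎ ; P∘to = λ { (inj₁ ()) ; (inj₂ ()) } }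
splitBy {suc n} P with splitBy (λ i → P (suc i)) | P zero in P₀
... | record { k = k ; l = l ; τ = τ ; P∘to = P∘to } | true = record
  { k = suc k ; l = l ; τ = consˡ τ
  ; P∘to = λ { (inj₁ zero) → P₀ ; (inj₁ (suc a)) → P∘to (inj₁ a) ; (inj₂ b) → P∘to (inj₂ b) } }
... | record { k = k ; l = l ; τ = τ ; P∘to = P∘to } | false = record
  { k = k ; l = suc l ; τ = consʳ τ
  ; P∘to = λ { (inj₂ zero) → P₀ ; (inj₂ (suc b)) → P∘to (inj₂ b) ; (inj₁ a) → P∘to (inj₁ a) } }

Fin⇒≥1 : ∀ {k} → Fin k → k ≥ 1
Fin⇒≥1 i = >-nonZero⁻¹ _ {{nonZeroIndex i}}

module _ {n} {P : Fin n → Bool} (sp : Splitting P) where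
  open Splitting sp

  left-preimage : ∀ {e} → P e ≡ true → Σ (Fin k) λ a → Inverse.to τ (inj₁ a) ≡ e
  left-preimage {e} Pe with Inverse.from τ e | Inverse.strictlyInverseˡ τ e
  ... | inj₁ a | to-a≡e = a , to-a≡e
  ... | inj₂ b | refl   = ⊥-elim (true≢false (trans (sym Pe) (P∘to (inj₂ b))))

  right-preimage : ∀ {e} → P e ≡ false → Σ (Fin l) λ b → Inverse.to τ (inj₂ b) ≡ e
  right-preimage {e} ¬Pe with Inverse.from τ e | Inverse.strictlyInverseˡ τ e
  ... | inj₂ b | to-b≡e = b , to-b≡e
  ... | inj₁ a | refl   = ⊥-elim (true≢false (trans (sym (P∘to (inj₁ a))) ¬Pe))

  nonempty-left : ¬ (∀ e → P e ≡ false) → k ≥ 1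
  nonempty-left ¬all-false with ¬∀⟶∃¬ n (λ e → P e ≡ false) (λ e → P e Bool.≟ false) ¬all-false
  ... | e , Pe≢false = Fin⇒≥1 (proj₁ (left-preimage (¬-not Pe≢false)))

  nonempty-right : ¬ (∀ e → P e ≡ true) → l ≥ 1
  nonempty-right ¬all-true with ¬∀⟶∃¬ n (λ e → P e ≡ true) (λ e → P e Bool.≟ true) ¬all-true
  ... | e , Pe≢true = Fin⇒≥1 (proj₁ (right-preimage (¬-not Pe≢true)))

Rectangular : ∀ {k l n} → Matroid n → (Fin k ⊎ Fin l) ↔ Fin n → Set
Rectangular M τ = ∀ X Y X' Y' → IsBase M (glue X Y) → IsBase M (glue X' Y') → IsBase M (glue X Y')
  where open Glue τ

module _ {k l n} (M : Matroid n) (τ : (Fin k ⊎ Fin l) ↔ Fin n) where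
  open Glue τ
  open Inverse τ using (to; from; strictlyInverseˡ)

  fibre : (X₀ : Sub k) (Y₀ : Sub l) → IsBase M (glue X₀ Y₀) → Matroid k
  fibre X₀ Y₀ b₀ = record
    { isBase   = λ X → isBase M (glue X Y₀)
    ; nonempty = X₀ , b₀
    ; exchange = fibre-exchange
    }
    where
    fibre-exchange : ∀ X₁ X₂ → IsBase M (glue X₁ Y₀) → IsBase M (glue X₂ Y₀) →
      ∀ x → x ∈ₛ X₁ → x ∉ₛ X₂ → ∃ λ a → a ∈ₛ X₂ × a ∉ₛ X₁ × IsBase M (glue (swap X₁ x a) Y₀)
    fibre-exchange X₁ X₂ b₁ b₂ x x∈X₁ x∉X₂
      with exchange M _ _ b₁ b₂ (to (inj₁ x)) (trans (lookup-glue X₁ Y₀ (inj₁ x)) x∈X₁)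
                                             (trans (lookup-glue X₂ Y₀ (inj₁ x)) x∉X₂)
    ... | y , y∈B₂ , y∉B₁ , b with from y | strictlyInverseˡ y
    ...   | inj₁ a | refl = a , trans (sym (lookup-glue X₂ Y₀ (inj₁ a))) y∈B₂
                              , trans (sym (lookup-glue X₁ Y₀ (inj₁ a))) y∉B₁
                              , subst (IsBase M) (swap-glue X₁ Y₀ x a) b
    ...   | inj₂ c | refl = ⊥-elim (true≢false (begin
              true                               ≡⟨ y∈B₂ ⟨
              lookup (glue X₂ Y₀) (to (inj₂ c))  ≡⟨ lookup-glue X₂ Y₀ (inj₂ c) ⟩
              lookup Y₀ c                        ≡⟨ lookup-glue X₁ Y₀ (inj₂ c) ⟨
              lookup (glue X₁ Y₀) (to (inj₂ c))  ≡⟨ y∉B₁ ⟩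
              false                              ∎))
      where open ≡-Reasoning

module _ {k l n} {M : Matroid n} {τ : (Fin k ⊎ Fin l) ↔ Fin n} (rect : Rectangular M τ) where
  open Glue τ

  rectangular-∧ : ∀ X₀ Y₀ → IsBase M (glue X₀ Y₀) → ∀ X Y →
                  isBase M (glue X Y) ≡ isBase M (glue X Y₀) ∧ isBase M (glue X₀ Y)
  rectangular-∧ X₀ Y₀ b₀ X Y = ≡-from-true⇔true
    (λ b → cong₂ _∧_ (rect X Y X₀ Y₀ b b₀) (rect X₀ Y₀ X Y b₀ b))
    (λ b∧b → rect X Y₀ X₀ Y (∧-conicalˡ _ _ b∧b) (∧-conicalʳ _ _ b∧b))

  rectangular⇒oneSum : k ≥ 1 → l ≥ 1 → IsOneSum M
  rectangular⇒oneSum k≥1 l≥1 = k , l , k≥1 , l≥1 , M₁ , M₂ , σ , directSum≡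
    where
    B₀ : Sub n
    B₀ = proj₁ (nonempty M)
    X₀ : Sub k
    X₀ = left B₀
    Y₀ : Sub l
    Y₀ = right B₀
    b₀ : IsBase M (glue X₀ Y₀)
    b₀ = subst (IsBase M) (sym (glue-left-right B₀)) (proj₂ (nonempty M))
    M₁ : Matroid k
    M₁ = fibre M τ X₀ Y₀ b₀
    M₂ : Matroid l
    M₂ = fibre M (↔-trans swap-↔ τ) Y₀ X₀ (subst (IsBase M) (sym (glue-comm τ X₀ Y₀)) b₀)
    σ : Fin (k +ℕ l) ↔ Fin n
    σ = ↔-trans +↔⊎ τ
    directSum≡ : ∀ B → directSumBase M₁ M₂ B ≡ isBase M (relabel σ B)
    directSum≡ B = begin
      isBase M (glue X Y₀) ∧ isBase M (Glue.glue (↔-trans swap-↔ τ) Y X₀)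
        ≡⟨ cong (λ V → isBase M (glue X Y₀) ∧ isBase M V) (glue-comm τ X₀ Y) ⟩
      isBase M (glue X Y₀) ∧ isBase M (glue X₀ Y)  ≡⟨ rectangular-∧ X₀ Y₀ b₀ X Y ⟨
      isBase M (glue X Y)                          ≡⟨ cong (isBase M) (relabel-glue σ (λ _ → refl) B) ⟨
      isBase M (relabel σ B)                       ∎
      where
      open ≡-Reasoning
      X : Sub k
      X = take k B
      Y : Sub l
      Y = drop k B

oneSum⇒rectangular : ∀ {n} {M : Matroid n} → IsOneSum M →
  ∃₂ λ k l → k ≥ 1 × l ≥ 1 × Σ ((Fin k ⊎ Fin l) ↔ Fin n) (Rectangular M)
oneSum⇒rectangular {n} {M} (k , l , k≥1 , l≥1 , M₁ , M₂ , σ , directSum≡) =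
  k , l , k≥1 , l≥1 , τ , λ X Y X' Y' b b' → begin
    isBase M (glue X Y')       ≡⟨ glue-bases X Y' ⟩
    isBase M₁ X ∧ isBase M₂ Y' ≡⟨ cong₂ _∧_ (∧-conicalˡ _ (isBase M₂ Y) (trans (sym (glue-bases X Y)) b))
                                            (∧-conicalʳ (isBase M₁ X') _ (trans (sym (glue-bases X' Y')) b')) ⟩
    true                       ∎
  where
  open ≡-Reasoning
  τ : (Fin k ⊎ Fin l) ↔ Fin n
  τ = ↔-trans (↔-sym +↔⊎) σ
  open Glue τ
  glue-bases : ∀ X Y → isBase M (glue X Y) ≡ isBase M₁ X ∧ isBase M₂ Y
  glue-bases X Y = begin
    isBase M (glue X Y)
      ≡⟨ cong (isBase M) (trans (relabel-glue σ (λ e → sym (join-splitAt k l _)) (X ++ Y)) (cong₂ glue take≡X drop≡Y)) ⟨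
    isBase M (relabel σ (X ++ Y))                             ≡⟨ directSum≡ (X ++ Y) ⟨
    isBase M₁ (take k (X ++ Y)) ∧ isBase M₂ (drop k (X ++ Y)) ≡⟨ cong₂ (λ X' Y' → isBase M₁ X' ∧ isBase M₂ Y') take≡X drop≡Y ⟩
    isBase M₁ X ∧ isBase M₂ Y                                 ∎
    where
    take≡X : take k (X ++ Y) ≡ X
    take≡X = proj₁ (++-injective (take k (X ++ Y)) X (take++drop≡id k (X ++ Y)))
    drop≡Y : drop k (X ++ Y) ≡ Y
    drop≡Y = proj₂ (++-injective (take k (X ++ Y)) X (take++drop≡id k (X ++ Y)))

module _ {c} (_·_ : Fin c → Fin c → Fin c) where

  Additive : (Fin c → Bool) → Set
  Additive f = ∀ p q p' q' → boolℚ (f (p · q)) + boolℚ (f (p' · q')) ≡ boolℚ (f (p · q')) + boolℚ (f (p' · q))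

  -- Viewing F p q = f (p · q) as a 0/1 matrix with F p q + F p' q' = F p q' + F p' q:
  -- once some row of F is non-constant, no column can be, so f j = F j j = F j₀ j.
  additive-dichotomy : (∀ p → p · p ≡ p) → ∀ {f} → Additive f → ∀ j₀ →
                       (∀ j → f j ≡ f (j · j₀)) ⊎ (∀ j → f j ≡ f (j₀ · j))
  additive-dichotomy idem {f} add j₀ with all? (λ j → f j Bool.≟ f (j · j₀))
  ... | yes leftOnly = inj₁ leftOnly
  ... | no ¬leftOnly = inj₂ rightOnly
    where
    F : Fin c → Fin c → Bool
    F p q = f (p · q)
    diag : ∀ j → F j j ≡ f j
    diag j = cong f (idem j)
    witness : ∃ λ j → f j ≢ f (j · j₀)
    witness = ¬∀⟶∃¬ c (λ j → f j ≡ f (j · j₀)) (λ j → f j Bool.≟ f (j · j₀)) ¬leftOnly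
    j₁ : Fin c
    j₁ = proj₁ witness
    F₁₁≢F₁₀ : F j₁ j₁ ≢ F j₁ j₀
    F₁₁≢F₁₀ eq = proj₂ witness (trans (sym (diag j₁)) eq)
    vary-in-q : ∀ p q p' q' → F p q ≢ F p q' → F p q ≡ F p' q × F p' q' ≡ F p q'
    vary-in-q p q p' q' = boolℚ-interchange (add p q p' q')
    vary-in-p : ∀ p q p' q' → F p q ≢ F p' q → F p q ≡ F p q' × F p' q' ≡ F p' q
    vary-in-p p q p' q' = boolℚ-interchange (trans (add p q p' q') (ℚᴾ.+-comm (boolℚ (F p q')) (boolℚ (F p' q))))
    rightOnly : ∀ j → f j ≡ f (j₀ · j)
    rightOnly j with f j Bool.≟ f (j₀ · j)
    ... | yes eq = eq
    ... | no  ne = ⊥-elim (F₁₁≢F₁₀ (begin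
      F j₁ j₁ ≡⟨ proj₁ (vary-in-q j₁ j₁ j j₀ F₁₁≢F₁₀) ⟩
      F j j₁  ≡⟨ proj₁ (vary-in-p j j j₀ j₁ Fjj≢F₀j) ⟨
      F j j   ≡⟨ proj₁ (vary-in-p j j j₀ j₀ Fjj≢F₀j) ⟩
      F j j₀  ≡⟨ proj₂ (vary-in-q j₁ j₁ j j₀ F₁₁≢F₁₀) ⟩
      F j₁ j₀ ∎))
      where
      open ≡-Reasoning
      Fjj≢F₀j : F j j ≢ F j₀ j
      Fjj≢F₀j eq = ne (trans (sym (diag j)) eq)

record IsRectangularBand {c} (_·_ : Fin c → Fin c → Fin c) : Set where
  field
    idem    : ∀ p → p · p ≡ p
    absorbˡ : ∀ p q r → (p · q) · r ≡ p · r
    absorbʳ : ∀ p q r → p · (q · r) ≡ p · r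

module RectangularBand {c} {_·_ : Fin c → Fin c → Fin c} (band : IsRectangularBand _·_) (j₀ : Fin c) where
  open IsRectangularBand band

  private
    inLeftFactor inRightFactor : Fin c → Bool
    inLeftFactor  j = does (j · j₀ ≟ᶠ j)
    inRightFactor j = does (j₀ · j ≟ᶠ j)
    module L = Splitting (splitBy inLeftFactor)
    module R = Splitting (splitBy inRightFactor)

  cˡ cʳ : ℕ
  cˡ = L.k
  cʳ = R.k

  colˡ : Fin cˡ → Fin c
  colˡ a = Inverse.to L.τ (inj₁ a)

  colʳ : Fin cʳ → Fin c
  colʳ b = Inverse.to R.τ (inj₁ b)

  colˡ-· : ∀ a → colˡ a · j₀ ≡ colˡ a
  colˡ-· a = from-does-true (colˡ a · j₀ ≟ᶠ colˡ a) (L.P∘to (inj₁ a))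

  colʳ-· : ∀ b → j₀ · colʳ b ≡ colʳ b
  colʳ-· b = from-does-true (j₀ · colʳ b ≟ᶠ colʳ b) (R.P∘to (inj₁ b))

  private
    indexˡ : ∀ j → Σ (Fin cˡ) λ a → colˡ a ≡ j · j₀
    indexˡ j = left-preimage (splitBy inLeftFactor) (dec-true ((j · j₀) · j₀ ≟ᶠ j · j₀) (absorbˡ j j₀ j₀))

    indexʳ : ∀ j → Σ (Fin cʳ) λ b → colʳ b ≡ j₀ · j
    indexʳ j = left-preimage (splitBy inRightFactor) (dec-true (j₀ · (j₀ · j) ≟ᶠ j₀ · j) (absorbʳ j₀ j₀ j))

  cˡ≥1 : cˡ ≥ 1
  cˡ≥1 = Fin⇒≥1 (proj₁ (indexˡ j₀))

  cʳ≥1 : cʳ ≥ 1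
  cʳ≥1 = Fin⇒≥1 (proj₁ (indexʳ j₀))

  κ : (Fin cˡ × Fin cʳ) ↔ Fin c
  κ = mk↔ₛ′ combine factor combine∘factor factor∘combine
    where
    open ≡-Reasoning
    combine : Fin cˡ × Fin cʳ → Fin c
    combine (a , b) = colˡ a · colʳ b
    factor : Fin c → Fin cˡ × Fin cʳ
    factor j = proj₁ (indexˡ j) , proj₁ (indexʳ j)
    combine∘factor : ∀ j → combine (factor j) ≡ j
    combine∘factor j = begin
      colˡ (proj₁ (indexˡ j)) · colʳ (proj₁ (indexʳ j)) ≡⟨ cong₂ _·_ (proj₂ (indexˡ j)) (proj₂ (indexʳ j)) ⟩
      (j · j₀) · (j₀ · j)                               ≡⟨ absorbˡ j j₀ (j₀ · j) ⟩
      j · (j₀ · j)                                      ≡⟨ absorbʳ j j₀ j ⟩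
      j · j                                             ≡⟨ idem j ⟩
      j                                                 ∎
    factor∘combine : ∀ q → factor (combine q) ≡ q
    factor∘combine (a , b) = cong₂ _,_
      (inj₁-injective (Injection.injective (↔⇒↣ L.τ) (begin
        colˡ (proj₁ (indexˡ (colˡ a · colʳ b))) ≡⟨ proj₂ (indexˡ (colˡ a · colʳ b)) ⟩
        (colˡ a · colʳ b) · j₀                  ≡⟨ absorbˡ (colˡ a) (colʳ b) j₀ ⟩
        colˡ a · j₀                             ≡⟨ colˡ-· a ⟩
        colˡ a                                  ∎)))
      (inj₁-injective (Injection.injective (↔⇒↣ R.τ) (begin
        colʳ (proj₁ (indexʳ (colˡ a · colʳ b))) ≡⟨ proj₂ (indexʳ (colˡ a · colʳ b)) ⟩
        j₀ · (colˡ a · colʳ b)                  ≡⟨ absorbʳ j₀ (colˡ a) (colʳ b) ⟩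
        j₀ · colʳ b                             ≡⟨ colʳ-· b ⟩
        colʳ b                                  ∎)))

  module _ {m} (S : BMat m c) where

    LeftOnly RightOnly : Fin m → Set
    LeftOnly  i = ∀ j → S i j ≡ S i (j · j₀)
    RightOnly i = ∀ j → S i j ≡ S i (j₀ · j)

    leftOnly∧rightOnly⇒constant : ∀ {i} → LeftOnly i → RightOnly i → ConstantRow S i
    leftOnly∧rightOnly⇒constant {i} lo ro = S i (j₀ · j₀) , λ j → begin
      S i j                  ≡⟨ lo j ⟩
      S i (j · j₀)           ≡⟨ ro (j · j₀) ⟩
      S i (j₀ · (j · j₀))    ≡⟨ cong (S i) (absorbʳ j₀ j j₀) ⟩
      S i (j₀ · j₀)          ∎
      where open ≡-Reasoning

    leftOnly? : ∀ i → Dec (LeftOnly i)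
    leftOnly? i = all? (λ j → S i j Bool.≟ S i (j · j₀))

    oneProduct : (∀ i → Additive _·_ (S i)) → (∀ i → ¬ ConstantRow S i) →
                 ∃ LeftOnly → ∃ RightOnly → IsOneProduct S
    oneProduct additive nonconstant (iˡ , iˡ-leftOnly) (iʳ , iʳ-rightOnly) =
      Q.k , cˡ , Q.l , cʳ , Fin⇒≥1 (proj₁ (left-preimage Qsplit Q-iˡ)) , cˡ≥1 ,
      Fin⇒≥1 (proj₁ (right-preimage Qsplit Q-iʳ)) , cʳ≥1 , S₁ , S₂ , Q.τ , κ , blocks
      where
      open ≡-Reasoning
      Qsplit : Splitting (λ i → does (leftOnly? i))
      Qsplit = splitBy (λ i → does (leftOnly? i))
      module Q = Splitting Qsplit
      Q-iˡ : does (leftOnly? iˡ) ≡ true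
      Q-iˡ = dec-true (leftOnly? iˡ) iˡ-leftOnly
      Q-iʳ : does (leftOnly? iʳ) ≡ false
      Q-iʳ = dec-false (leftOnly? iʳ) λ lo → nonconstant iʳ (leftOnly∧rightOnly⇒constant lo iʳ-rightOnly)
      rowˡ : Fin Q.k → Fin m
      rowˡ r = Inverse.to Q.τ (inj₁ r)
      rowʳ : Fin Q.l → Fin m
      rowʳ r = Inverse.to Q.τ (inj₂ r)
      rowˡ-leftOnly : ∀ r → LeftOnly (rowˡ r)
      rowˡ-leftOnly r = from-does-true (leftOnly? (rowˡ r)) (Q.P∘to (inj₁ r))
      rowʳ-rightOnly : ∀ r → RightOnly (rowʳ r)
      rowʳ-rightOnly r with additive-dichotomy _·_ idem (additive (rowʳ r)) j₀
      ... | inj₁ lo = ⊥-elim (from-does-false (leftOnly? (rowʳ r)) (Q.P∘to (inj₂ r)) lo)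
      ... | inj₂ ro = ro
      S₁ : BMat Q.k cˡ
      S₁ r a = S (rowˡ r) (colˡ a)
      S₂ : BMat Q.l cʳ
      S₂ r b = S (rowʳ r) (colʳ b)
      blocks : ∀ r q → S (Inverse.to Q.τ r) (Inverse.to κ q) ≡ tensor S₁ S₂ r q
      blocks (inj₁ r) (a , b) = begin
        S (rowˡ r) (colˡ a · colʳ b)         ≡⟨ rowˡ-leftOnly r _ ⟩
        S (rowˡ r) ((colˡ a · colʳ b) · j₀)  ≡⟨ cong (S (rowˡ r)) (trans (absorbˡ (colˡ a) (colʳ b) j₀) (colˡ-· a)) ⟩
        S (rowˡ r) (colˡ a)                  ∎
      blocks (inj₂ r) (a , b) = begin
        S (rowʳ r) (colˡ a · colʳ b)         ≡⟨ rowʳ-rightOnly r _ ⟩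
        S (rowʳ r) (j₀ · (colˡ a · colʳ b))  ≡⟨ cong (S (rowʳ r)) (trans (absorbʳ j₀ (colˡ a) (colʳ b)) (colʳ-· b)) ⟩
        S (rowʳ r) (colʳ b)                  ∎

module ColumnBand {n m c k l} {M : Matroid n} {S : BMat m c} (D : SlackData M S)
                  {τ : (Fin k ⊎ Fin l) ↔ Fin n} (rect : Rectangular M τ) where
  open SlackData D
  open Glue τ
  open ≡-Reasoning

  X : Fin c → Sub k
  X j = left (vert j)

  Y : Fin c → Sub l
  Y j = right (vert j)

  glue-base : ∀ p q → IsBase M (glue (X p) (Y q))
  glue-base p q = rect (X p) (Y p) (X q) (Y q) (split-base p) (split-base q)
    where
    split-base : ∀ j → IsBase M (glue (X j) (Y j))
    split-base j = subst (IsBase M) (sym (glue-left-right (vert j))) (vert-base j)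

  _·_ : Fin c → Fin c → Fin c
  p · q = proj₁ (vert-surj _ (glue-base p q))

  vert-· : ∀ p q → vert (p · q) ≡ glue (X p) (Y q)
  vert-· p q = proj₂ (vert-surj _ (glue-base p q))

  X-· : ∀ p q → X (p · q) ≡ X p
  X-· p q = trans (cong left (vert-· p q)) (left-glue (X p) (Y q))

  Y-· : ∀ p q → Y (p · q) ≡ Y q
  Y-· p q = trans (cong right (vert-· p q)) (right-glue (X p) (Y q))

  ·-unique : ∀ {p q j} → X j ≡ X p → Y j ≡ Y q → p · q ≡ j
  ·-unique {p} {q} {j} Xj≡Xp Yj≡Yq = vert-inj _ _ (begin
    vert (p · q)      ≡⟨ vert-· p q ⟩
    glue (X p) (Y q)  ≡⟨ cong₂ glue Xj≡Xp Yj≡Yq ⟨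
    glue (X j) (Y j)  ≡⟨ glue-left-right (vert j) ⟩
    vert j            ∎)

  band : IsRectangularBand _·_
  band = record
    { idem    = λ p → ·-unique refl refl
    ; absorbˡ = λ p q r → sym (·-unique (trans (X-· (p · q) r) (X-· p q)) (Y-· (p · q) r))
    ; absorbʳ = λ p q r → sym (·-unique (X-· p (q · r)) (trans (Y-· p (q · r)) (Y-· q r)))
    }

  additive : ∀ i → Additive _·_ (S i)
  additive i p q p' q' = begin
    boolℚ (S i (p · q)) + boolℚ (S i (p' · q'))
      ≡⟨ cong₂ _+_ (slack-· p q) (slack-· p' q') ⟩
    (b i - dot (A i) (χ (glue (X p) (Y q)))) + (b i - dot (A i) (χ (glue (X p') (Y q'))))
      ≡⟨ slack-interchange (A i) (b i) (χ-glue-interchange (X p) (Y q) (X p') (Y q')) ⟩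
    (b i - dot (A i) (χ (glue (X p) (Y q')))) + (b i - dot (A i) (χ (glue (X p') (Y q))))
      ≡⟨ cong₂ _+_ (slack-· p q') (slack-· p' q) ⟨
    boolℚ (S i (p · q')) + boolℚ (S i (p' · q))
      ∎
    where
    slack-· : ∀ p q → boolℚ (S i (p · q)) ≡ b i - dot (A i) (χ (glue (X p) (Y q)))
    slack-· p q = trans (slack i (p · q)) (cong (λ V → b i - dot (A i) (χ V)) (vert-· p q))

module _ {n m c} {M : Matroid n} {S : BMat m c} (D : SlackData M S)
         (nonconstant : ∀ i → ¬ ConstantRow S i) (nonnegRow : ∀ e → ∃ λ i → RowNonneg D i e) where
  open SlackData D

  rectangular⇒oneProduct : ∀ {k l} {τ : (Fin k ⊎ Fin l) ↔ Fin n} → k ≥ 1 → l ≥ 1 →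
                           Rectangular M τ → IsOneProduct S
  rectangular⇒oneProduct {k} {l} {τ} k≥1 l≥1 rect =
    RectangularBand.oneProduct band j₀ S additive nonconstant
      (leftRow , leftRow-leftOnly) (rightRow , rightRow-rightOnly)
    where
    open ColumnBand D {τ = τ} rect
    open Glue τ using (lookup-left; lookup-right)
    open ≡-Reasoning

    j₀ : Fin c
    j₀ = proj₁ (vert-surj _ (proj₂ (nonempty M)))

    a₀ : Fin k
    a₀ = fromℕ< k≥1

    b₀ : Fin l
    b₀ = fromℕ< l≥1

    leftRow rightRow : Fin m
    leftRow  = proj₁ (nonnegRow (Inverse.to τ (inj₁ a₀)))
    rightRow = proj₁ (nonnegRow (Inverse.to τ (inj₂ b₀)))

    leftRow-slack : ∀ j → S leftRow j ≡ lookup (X j) a₀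
    leftRow-slack j = trans (nonnegRow-slack D (proj₂ (nonnegRow _)) j) (sym (lookup-left (vert j) a₀))

    rightRow-slack : ∀ j → S rightRow j ≡ lookup (Y j) b₀
    rightRow-slack j = trans (nonnegRow-slack D (proj₂ (nonnegRow _)) j) (sym (lookup-right (vert j) b₀))

    leftRow-leftOnly : ∀ j → S leftRow j ≡ S leftRow (j · j₀)
    leftRow-leftOnly j = begin
      S leftRow j             ≡⟨ leftRow-slack j ⟩
      lookup (X j) a₀         ≡⟨ cong (λ V → lookup V a₀) (X-· j j₀) ⟨
      lookup (X (j · j₀)) a₀  ≡⟨ leftRow-slack (j · j₀) ⟨
      S leftRow (j · j₀)      ∎

    rightRow-rightOnly : ∀ j → S rightRow j ≡ S rightRow (j₀ · j)
    rightRow-rightOnly j = begin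
      S rightRow j            ≡⟨ rightRow-slack j ⟩
      lookup (Y j) b₀         ≡⟨ cong (λ V → lookup V b₀) (Y-· j₀ j) ⟨
      lookup (Y (j₀ · j)) b₀  ≡⟨ rightRow-slack (j₀ · j) ⟨
      S rightRow (j₀ · j)     ∎

module _ {m₁ c₁ m₂ c₂} (S₁ : BMat m₁ c₁) (S₂ : BMat m₂ c₂) where

  tensor-left : ∀ {r} → isLeft r ≡ true → ∀ j₁ j₂ j₂' → tensor S₁ S₂ r (j₁ , j₂) ≡ tensor S₁ S₂ r (j₁ , j₂')
  tensor-left {inj₁ r} _ _ _ _ = refl

  tensor-right : ∀ {r} → isLeft r ≡ false → ∀ j₁ j₁' j₂ → tensor S₁ S₂ r (j₁ , j₂) ≡ tensor S₁ S₂ r (j₁' , j₂)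
  tensor-right {inj₂ r} _ _ _ _ = refl

module OneProductSplit {n m c} {M : Matroid n} {S : BMat m c} (D : SlackData M S)
    (nonnegRow : ∀ e → ∃ λ i → RowNonneg D i e)
    {m₁ c₁ m₂ c₂} {S₁ : BMat m₁ c₁} {S₂ : BMat m₂ c₂}
    (ρ : (Fin m₁ ⊎ Fin m₂) ↔ Fin m) (κ : (Fin c₁ × Fin c₂) ↔ Fin c)
    (blocks : ∀ r q → S (Inverse.to ρ r) (Inverse.to κ q) ≡ tensor S₁ S₂ r q) where
  open SlackData D
  open ≡-Reasoning

  block : Fin n → Fin m₁ ⊎ Fin m₂
  block e = Inverse.from ρ (proj₁ (nonnegRow e))

  E : Splitting (λ e → isLeft (block e))
  E = splitBy (λ e → isLeft (block e))

  open Splitting E public using (τ)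
  open Splitting E using (P∘to)
  open Glue τ
  open Inverse τ using (to)

  W : Fin c₁ × Fin c₂ → Sub n
  W q = vert (Inverse.to κ q)

  W-injective : ∀ {q q'} → W q ≡ W q' → q ≡ q'
  W-injective eq = Injection.injective (↔⇒↣ κ) (vert-inj _ _ eq)

  W-of-base : ∀ {B} → IsBase M B → Σ (Fin c₁ × Fin c₂) λ q → W q ≡ B
  W-of-base b with vert-surj _ b
  ... | j , vert-j≡B = Inverse.from κ j , trans (cong vert (Inverse.strictlyInverseˡ κ j)) vert-j≡B

  lookup-W : ∀ e q → lookup (W q) e ≡ tensor S₁ S₂ (block e) q
  lookup-W e q = begin
    lookup (W q) e                               ≡⟨ nonnegRow-slack D (proj₂ (nonnegRow e)) _ ⟨
    S (proj₁ (nonnegRow e)) (Inverse.to κ q)     ≡⟨ cong (λ i → S i (Inverse.to κ q)) (Inverse.strictlyInverseˡ ρ _) ⟨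
    S (Inverse.to ρ (block e)) (Inverse.to κ q)  ≡⟨ blocks (block e) q ⟩
    tensor S₁ S₂ (block e) q                     ∎

  left-W : ∀ j₁ j₂ j₂' → left (W (j₁ , j₂)) ≡ left (W (j₁ , j₂'))
  left-W j₁ j₂ j₂' = lookup-ext (left (W (j₁ , j₂))) (left (W (j₁ , j₂'))) λ a → begin
    lookup (left (W (j₁ , j₂))) a                  ≡⟨ lookup-left (W (j₁ , j₂)) a ⟩
    lookup (W (j₁ , j₂)) (to (inj₁ a))             ≡⟨ lookup-W (to (inj₁ a)) (j₁ , j₂) ⟩
    tensor S₁ S₂ (block (to (inj₁ a))) (j₁ , j₂)   ≡⟨ tensor-left S₁ S₂ {block (to (inj₁ a))} (P∘to (inj₁ a)) j₁ j₂ j₂' ⟩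
    tensor S₁ S₂ (block (to (inj₁ a))) (j₁ , j₂')  ≡⟨ lookup-W (to (inj₁ a)) (j₁ , j₂') ⟨
    lookup (W (j₁ , j₂')) (to (inj₁ a))            ≡⟨ lookup-left (W (j₁ , j₂')) a ⟨
    lookup (left (W (j₁ , j₂'))) a                 ∎

  right-W : ∀ j₁ j₁' j₂ → right (W (j₁ , j₂)) ≡ right (W (j₁' , j₂))
  right-W j₁ j₁' j₂ = lookup-ext (right (W (j₁ , j₂))) (right (W (j₁' , j₂))) λ b → begin
    lookup (right (W (j₁ , j₂))) b                 ≡⟨ lookup-right (W (j₁ , j₂)) b ⟩
    lookup (W (j₁ , j₂)) (to (inj₂ b))             ≡⟨ lookup-W (to (inj₂ b)) (j₁ , j₂) ⟩
    tensor S₁ S₂ (block (to (inj₂ b))) (j₁ , j₂)   ≡⟨ tensor-right S₁ S₂ {block (to (inj₂ b))} (P∘to (inj₂ b)) j₁ j₁' j₂ ⟩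
    tensor S₁ S₂ (block (to (inj₂ b))) (j₁' , j₂)  ≡⟨ lookup-W (to (inj₂ b)) (j₁' , j₂) ⟨
    lookup (W (j₁' , j₂)) (to (inj₂ b))            ≡⟨ lookup-right (W (j₁' , j₂)) b ⟨
    lookup (right (W (j₁' , j₂))) b                ∎

  rect : Rectangular M τ
  rect X Y X' Y' b b' with W-of-base b | W-of-base b'
  ... | (j₁ , j₂) , W≡XY | (j₁' , j₂') , W≡X'Y' = subst (IsBase M) W≡XY' (vert-base _)
    where
    W≡XY' : W (j₁ , j₂') ≡ glue X Y'
    W≡XY' = begin
      W (j₁ , j₂')                                       ≡⟨ glue-left-right (W (j₁ , j₂')) ⟨
      glue (left (W (j₁ , j₂'))) (right (W (j₁ , j₂')))  ≡⟨ cong₂ glue (left-W j₁ j₂' j₂) (right-W j₁ j₁' j₂') ⟩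
      glue (left (W (j₁ , j₂))) (right (W (j₁' , j₂')))  ≡⟨ cong₂ glue (trans (cong left W≡XY) (left-glue X Y))
                                                                      (trans (cong right W≡X'Y') (right-glue X' Y')) ⟩
      glue X Y'                                          ∎

  all-right⇒W-ignores-j₁ : (∀ e → isLeft (block e) ≡ false) → ∀ j₁ j₁' j₂ → W (j₁ , j₂) ≡ W (j₁' , j₂)
  all-right⇒W-ignores-j₁ all-right j₁ j₁' j₂ = lookup-ext (W (j₁ , j₂)) (W (j₁' , j₂)) λ e →
    trans (lookup-W e _) (trans (tensor-right S₁ S₂ {block e} (all-right e) j₁ j₁' j₂) (sym (lookup-W e _)))

  all-left⇒W-ignores-j₂ : (∀ e → isLeft (block e) ≡ true) → ∀ j₁ j₂ j₂' → W (j₁ , j₂) ≡ W (j₁ , j₂')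
  all-left⇒W-ignores-j₂ all-left j₁ j₂ j₂' = lookup-ext (W (j₁ , j₂)) (W (j₁ , j₂')) λ e →
    trans (lookup-W e _) (trans (tensor-left S₁ S₂ {block e} (all-left e) j₁ j₂ j₂') (sym (lookup-W e _)))

  constant-block⇒constantRow : ∀ r q₀ → (∀ q → tensor S₁ S₂ r q ≡ tensor S₁ S₂ r q₀) →
                               ConstantRow S (Inverse.to ρ r)
  constant-block⇒constantRow r q₀ const = tensor S₁ S₂ r q₀ , λ j → begin
    S (Inverse.to ρ r) j                                  ≡⟨ cong (S (Inverse.to ρ r)) (Inverse.strictlyInverseˡ κ j) ⟨
    S (Inverse.to ρ r) (Inverse.to κ (Inverse.from κ j))  ≡⟨ blocks r _ ⟩
    tensor S₁ S₂ r (Inverse.from κ j)                     ≡⟨ const _ ⟩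
    tensor S₁ S₂ r q₀                                     ∎

module _ {n m c} {M : Matroid n} {S : BMat m c} (D : SlackData M S)
         (nonconstant : ∀ i → ¬ ConstantRow S i) (nonnegRow : ∀ e → ∃ λ i → RowNonneg D i e) where

  oneProduct⇒oneSum : IsOneProduct S → IsOneSum M
  oneProduct⇒oneSum (m₁ , c₁ , m₂ , c₂ , m₁≥1 , c₁≥1 , m₂≥1 , c₂≥1 , S₁ , S₂ , ρ , κ , blocks) =
    rectangular⇒oneSum {M = M} {τ = τ} rect (nonempty-left E ¬all-right) (nonempty-right E ¬all-left)
    where
    open OneProductSplit D nonnegRow ρ κ blocks
    r₁ : Fin m₁
    r₁ = fromℕ< m₁≥1
    r₂ : Fin m₂
    r₂ = fromℕ< m₂≥1
    q₀ : Fin c₁ × Fin c₂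
    q₀ = fromℕ< c₁≥1 , fromℕ< c₂≥1

    ¬all-right : ¬ (∀ e → isLeft (block e) ≡ false)
    ¬all-right all-right = nonconstant _ (constant-block⇒constantRow (inj₁ r₁) q₀ λ (j₁ , _) →
      cong (S₁ r₁) (cong proj₁ (W-injective (all-right⇒W-ignores-j₁ all-right j₁ (proj₁ q₀) (proj₂ q₀)))))

    ¬all-left : ¬ (∀ e → isLeft (block e) ≡ true)
    ¬all-left all-left = nonconstant _ (constant-block⇒constantRow (inj₂ r₂) q₀ λ (_ , j₂) →
      cong (S₂ r₂) (cong proj₂ (W-injective (all-left⇒W-ignores-j₂ all-left (proj₁ q₀) j₂ (proj₂ q₀)))))

-- The hypotheses on loops and coloops are implied by the non-constancy of the x_e ≥ 0 rows.
corollary4p4 : ∀ {n m c : ℕ} (M : Matroid n) →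
    (∀ e → ¬ IsLoop M e) → (∀ e → ¬ IsColoop M e) →
    TwoLevel M →
    (S : BMat m c) (D : SlackData M S) →
    (∀ i → ¬ ConstantRow S i) →
    (∀ e → ∃ λ i → RowNonneg D i e) →
    (∀ e → ∃ λ i → RowUpper D i e) →
    Connected M ⇔ Irreducible S
corollary4p4 M _ _ _ S D nonconstant nonnegRow _ = mk⇔
  (λ connected oneProduct → connected (oneProduct⇒oneSum D nonconstant nonnegRow oneProduct))
  (λ irreducible oneSum →
    let k , l , k≥1 , l≥1 , τ , rect = oneSum⇒rectangular {M = M} oneSum
    in irreducible (rectangular⇒oneProduct D nonconstant nonnegRow {τ = τ} k≥1 l≥1 rect))
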